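{- Let $p$ and $w$ be permutations with $p \prec w$. Then $|R(p)| \le |R(w)|$.
   Context: For a permutation $w\in\mathfrak{S}_n$, write $\sigma_i$ ($1\le i<n$) for the adjacent transposition of $i$ and $i+1$. If $w=\sigma_{i_1}\cdots\sigma_{i_\ell}$ with $\ell$ minimal, the string $i_1\cdots i_\ell$ is a reduced word of $w$, and $R(w)$ denotes the set of reduced words of $w$. For $p\in\mathfrak{S}_k$, $p\prec w$ means $w$ contains the pattern $p$: there exist $i_1<\cdots<i_k$ such that $w(i_1)\cdots w(i_k)$ is in the same relative order as $p(1)\cdots p(k)$. -}

module Defs where

open import Data.Nat using (ℕ; zero; suc; _∸_; _≤_; _<_; _≟_)
open import Data.Fin as F using (Fin; toℕ)
open import Data.Fin.Permutation using (Permutation′; _⟨$⟩ʳ_)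
open import Data.List using (List; []; _∷_; length)
open import Data.List.Relation.Unary.All using (All)
open import Data.List.Relation.Unary.Unique.Propositional using (Unique)
open import Data.List.Membership.Propositional using (_∈_)
open import Data.Product using (Σ; ∃; _×_)
open import Relation.Binary.PropositionalEquality using (_≡_)
open import Relation.Nullary using (yes; no)

-- Positions are 0-indexed naturals (position x corresponds to the
-- paper's value x+1).  The adjacent transposition σ_i (1 ≤ i < n),
-- which swaps the paper's i and i+1, swaps 0-indexed i ∸ 1 and i.
σ : ℕ → ℕ → ℕ
σ i x with suc x ≟ i
... | yes _ = i
... | no _ with x ≟ i
...   | yes _ = i ∸ 1
...   | no _ = x

act : List ℕ → ℕ → ℕ
act [] x = x
act (i ∷ is) x = σ i (act is x)

ValidWord : ℕ → List ℕ → Set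
ValidWord n ws = All (λ i → 1 ≤ i × i < n) ws

IsWord : (n : ℕ) → Permutation′ n → List ℕ → Set
IsWord n w ws = ValidWord n ws × ((x : Fin n) → act ws (toℕ x) ≡ toℕ (w ⟨$⟩ʳ x))

IsReduced : (n : ℕ) → Permutation′ n → List ℕ → Set
IsReduced n w ws = IsWord n w ws × ((vs : List ℕ) → IsWord n w vs → length ws ≤ length vs)

CardR : (n : ℕ) → Permutation′ n → ℕ → Set
CardR n w k = Σ (List (List ℕ)) λ L →
  Unique L × ((ws : List ℕ) → (ws ∈ L → IsReduced n w ws) × (IsReduced n w ws → ws ∈ L))
  × length L ≡ k

Contains : {k n : ℕ} → Permutation′ k → Permutation′ n → Set
Contains {k} {n} p w = Σ (Fin k → Fin n) λ f →
  ((a b : Fin k) → a F.< b → f a F.< f b) ×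
  ((a b : Fin k) → (p ⟨$⟩ʳ a F.< p ⟨$⟩ʳ b → w ⟨$⟩ʳ f a F.< w ⟨$⟩ʳ f b)
                 × (w ⟨$⟩ʳ f a F.< w ⟨$⟩ʳ f b → p ⟨$⟩ʳ a F.< p ⟨$⟩ʳ b))

-- The length of a permutation is its number of inversions, and σ_c u has one inversion fewer
-- than u exactly when c + 1 precedes c in u. Fix an occurrence of p in w and restrict words for
-- w to it: keep the letters swapping two values of the occurrence, renamed to the corresponding
-- letters of 𝔖ₖ. Every reduced word v of p is the restriction of a reduced word of w, built
-- letter by letter by induction on the number of inversions of w. If v = σ_j v′, the occurrence
-- values x₀ < x₁ flattening to j, j + 1 are inverted in w; if x₁ = x₀ + 1 the letter σ_{x₁} lifts
-- σ_j, and otherwise some descent of w between x₀ and x₁ swaps two values not both in the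
-- occurrence, leaving the flattening unchanged. If v is empty the occurrence is increasing and any
-- descent of w will do. Hence the restrictions of R(w) include all of R(p), and |R(p)| ≤ |R(w)|.

module Submission where

open import Defs
open import Data.Nat
open import Data.Nat.Properties
open import Data.Fin as Fin using (Fin; toℕ; fromℕ<)
open import Data.Fin.Properties using (toℕ<n; toℕ≤n; toℕ-fromℕ<; fromℕ<-toℕ; toℕ-inject₁; toℕ-fromℕ)
open import Data.Fin.Permutation using (Permutation′; _⟨$⟩ʳ_; _⟨$⟩ˡ_; inverseˡ; inverseʳ)
open import Data.List using (List; []; _∷_; length; reverse; map; _++_; [_])
open import Data.List.Properties using (length-map; length-++-sucʳ; unfold-reverse; reverse-involutive)
open import Data.List.Relation.Unary.All using ([]; _∷_; lookup)
open import Data.List.Relation.Unary.All.Properties using (∷ʳ⁺)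
open import Data.List.Relation.Unary.AllPairs using (_∷_)
open import Data.List.Relation.Unary.Any using (here; there)
open import Data.List.Relation.Unary.Unique.Propositional using (Unique)
open import Data.List.Membership.Propositional using (_∈_)
open import Data.List.Membership.Propositional.Properties using (∈-map⁺; ∈-∃++; ∈-++⁻; ∈-++⁺ˡ; ∈-++⁺ʳ)
open import Data.Product using (∃; _×_; _,_; proj₁; proj₂)
open import Data.Sum using (inj₁; inj₂)
open import Function using (_∘_)
open import Relation.Nullary using (¬_; Dec; yes; no; contradiction; _×-dec_)
open import Relation.Binary.PropositionalEquality hiding ([_])
open import Relation.Binary.Definitions using (tri<; tri≈; tri>)
open import Algebra.Properties.CommutativeMonoid.Sum +-0-commutativeMonoid
  using (sum; sum-cong-≗; sum-init-last; sum-permute)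

private
  ∀<-pred : ∀ {n} {P : ℕ → Set} → (∀ x → x < suc n → P x) → ∀ x → x < n → P x
  ∀<-pred h x x<n = h x (m<n⇒m<1+n x<n)

  <-suc-≢ : ∀ {a k} → a < suc k → a ≢ k → a < k
  <-suc-≢ a<sk a≢k = ≤∧≢⇒< (≤-pred a<sk) a≢k

∑< : ℕ → (ℕ → ℕ) → ℕ
∑< zero    f = 0
∑< (suc n) f = ∑< n f + f n

∑<-cong : ∀ n {f g} → (∀ x → x < n → f x ≡ g x) → ∑< n f ≡ ∑< n g
∑<-cong zero    h = refl
∑<-cong (suc n) h = cong₂ _+_ (∑<-cong n (∀<-pred h)) (h n ≤-refl)

∑<-zeros : ∀ n {f} → (∀ x → x < n → f x ≡ 0) → ∑< n f ≡ 0
∑<-zeros zero    h = refl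
∑<-zeros (suc n) h = cong₂ _+_ (∑<-zeros n (∀<-pred h)) (h n ≤-refl)

∑<-mono-≤ : ∀ n {f g} → (∀ x → x < n → f x ≤ g x) → ∑< n f ≤ ∑< n g
∑<-mono-≤ zero    h = z≤n
∑<-mono-≤ (suc n) h = +-mono-≤ (∑<-mono-≤ n (∀<-pred h)) (h n ≤-refl)

∑<-mono-< : ∀ n {f g} m → m < n → f m < g m → (∀ x → x < n → f x ≤ g x) → ∑< n f < ∑< n g
∑<-mono-< (suc n) m m<n fm<gm h with m ≟ n
... | yes refl = +-mono-≤-< (∑<-mono-≤ n (∀<-pred h)) fm<gm
... | no m≢n   = +-mono-<-≤ (∑<-mono-< n m (<-suc-≢ m<n m≢n) fm<gm (∀<-pred h)) (h n ≤-refl)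

term≤∑< : ∀ n f {x} → x < n → f x ≤ ∑< n f
term≤∑< (suc n) f {x} x<n with x ≟ n
... | yes refl = m≤n+m (f x) (∑< x f)
... | no x≢n   = ≤-trans (term≤∑< n f (<-suc-≢ x<n x≢n)) (m≤m+n (∑< n f) (f n))

∑<-pos : ∀ n f → 0 < ∑< n f → ∃ λ x → x < n × 0 < f x
∑<-pos (suc n) f pos with f n in fn≡
... | suc _ = n , ≤-refl , subst (0 <_) (sym fn≡) z<s
... | zero with ∑<-pos n f (subst (0 <_) (+-identityʳ (∑< n f)) pos)
...   | x , x<n , fx>0 = x , m<n⇒m<1+n x<n , fx>0

∑<-exchange : ∀ n {f g} m → m < n → (∀ x → x < n → x ≢ m → f x ≡ g x) →
  ∑< n f + g m ≡ ∑< n g + f m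
∑<-exchange (suc n) {f} {g} m m<n h with m ≟ n
... | yes refl = begin
  ∑< n f + f n + g n ≡⟨ cong (λ s → s + f n + g n) (∑<-cong n (λ x x<n → h x (m<n⇒m<1+n x<n) (<⇒≢ x<n))) ⟩
  ∑< n g + f n + g n ≡⟨ +-assoc (∑< n g) (f n) (g n) ⟩
  ∑< n g + (f n + g n) ≡⟨ cong (∑< n g +_) (+-comm (f n) (g n)) ⟩
  ∑< n g + (g n + f n) ≡⟨ +-assoc (∑< n g) (g n) (f n) ⟨
  ∑< n g + g n + f n ∎
  where open ≡-Reasoning
... | no m≢n = begin
  ∑< n f + f n + g m ≡⟨ +-assoc (∑< n f) (f n) (g m) ⟩
  ∑< n f + (f n + g m) ≡⟨ cong (∑< n f +_) (+-comm (f n) (g m)) ⟩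
  ∑< n f + (g m + f n) ≡⟨ +-assoc (∑< n f) (g m) (f n) ⟨
  ∑< n f + g m + f n ≡⟨ cong₂ _+_ (∑<-exchange n m (<-suc-≢ m<n m≢n) (∀<-pred h)) (h n ≤-refl (m≢n ∘ sym)) ⟩
  ∑< n g + f m + g n ≡⟨ +-assoc (∑< n g) (f m) (g n) ⟩
  ∑< n g + (f m + g n) ≡⟨ cong (∑< n g +_) (+-comm (f m) (g n)) ⟩
  ∑< n g + (g n + f m) ≡⟨ +-assoc (∑< n g) (g n) (f m) ⟨
  ∑< n g + g n + f m ∎
  where open ≡-Reasoning

∑<≡sum : ∀ n f → ∑< n f ≡ sum {n} (f ∘ toℕ)
∑<≡sum zero    f = refl
∑<≡sum (suc n) f = begin
  ∑< n f + f n                                         ≡⟨ cong₂ _+_ (∑<≡sum n f) (cong f (sym (toℕ-fromℕ n))) ⟩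
  sum {n} (f ∘ toℕ) + f (toℕ (Fin.fromℕ n))
    ≡⟨ cong (_+ f (toℕ (Fin.fromℕ n))) (sum-cong-≗ {n} (λ i → cong f (sym (toℕ-inject₁ i)))) ⟩
  sum {n} (f ∘ toℕ ∘ Fin.inject₁) + f (toℕ (Fin.fromℕ n)) ≡⟨ sum-init-last (f ∘ toℕ) ⟨
  sum {suc n} (f ∘ toℕ) ∎
  where open ≡-Reasoning

χ< : ℕ → ℕ → ℕ
χ< zero    zero    = 0
χ< zero    (suc _) = 1
χ< (suc _) zero    = 0
χ< (suc a) (suc b) = χ< a b

χ<-1 : ∀ {a b} → a < b → χ< a b ≡ 1
χ<-1 {zero}  {suc b} _         = refl
χ<-1 {suc a} {suc b} (s≤s a<b) = χ<-1 a<b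

χ<-0 : ∀ {a b} → b ≤ a → χ< a b ≡ 0
χ<-0 {zero}  {zero}  _         = refl
χ<-0 {suc a} {zero}  _         = refl
χ<-0 {suc a} {suc b} (s≤s b≤a) = χ<-0 b≤a

χ<-pos : ∀ {a b} → 0 < χ< a b → a < b
χ<-pos {a} {b} pos with a <? b
... | yes a<b = a<b
... | no a≮b  = contradiction (χ<-0 (≮⇒≥ a≮b)) (>⇒≢ pos)

χ<-monoʳ-≤ : ∀ a {b c} → b ≤ c → χ< a b ≤ χ< a c
χ<-monoʳ-≤ a {b} b≤c with a <? b
... | yes a<b = ≤-reflexive (trans (χ<-1 a<b) (sym (χ<-1 (<-≤-trans a<b b≤c))))
... | no a≮b  = ≤-trans (≤-reflexive (χ<-0 (≮⇒≥ a≮b))) z≤n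

χ<-cong-⇔ : ∀ {a b c d} → (a < b → c < d) → (c < d → a < b) → χ< a b ≡ χ< c d
χ<-cong-⇔ {a} {b} to from with a <? b
... | yes a<b = trans (χ<-1 a<b) (sym (χ<-1 (to a<b)))
... | no a≮b  = trans (χ<-0 (≮⇒≥ a≮b)) (sym (χ<-0 (≮⇒≥ (a≮b ∘ from))))

χ<-sucʳ : ∀ {a b} → a ≢ b → χ< a (suc b) ≡ χ< a b
χ<-sucʳ a≢b = χ<-cong-⇔ (λ a<1+b → ≤∧≢⇒< (≤-pred a<1+b) a≢b) m<n⇒m<1+n

χ<-sucˡ : ∀ {a b} → b ≢ suc a → χ< (suc a) b ≡ χ< a b
χ<-sucˡ b≢1+a = χ<-cong-⇔ (λ 1+a<b → <-trans (n<1+n _) 1+a<b) (λ a<b → ≤∧≢⇒< a<b (b≢1+a ∘ sym))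

∑<-χ<-⊓ : ∀ k b → ∑< k (λ a → χ< a b) ≡ k ⊓ b
∑<-χ<-⊓ zero    b = refl
∑<-χ<-⊓ (suc k) b with k <? b
... | yes k<b = begin
  ∑< k (λ a → χ< a b) + χ< k b ≡⟨ cong₂ _+_ (∑<-χ<-⊓ k b) (χ<-1 k<b) ⟩
  k ⊓ b + 1                     ≡⟨ cong (_+ 1) (m≤n⇒m⊓n≡m (<⇒≤ k<b)) ⟩
  k + 1                         ≡⟨ +-comm k 1 ⟩
  suc k                         ≡⟨ m≤n⇒m⊓n≡m k<b ⟨
  suc k ⊓ b ∎
  where open ≡-Reasoning
... | no k≮b = begin
  ∑< k (λ a → χ< a b) + χ< k b ≡⟨ cong₂ _+_ (∑<-χ<-⊓ k b) (χ<-0 (≮⇒≥ k≮b)) ⟩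
  k ⊓ b + 0                     ≡⟨ +-identityʳ (k ⊓ b) ⟩
  k ⊓ b                         ≡⟨ m≥n⇒m⊓n≡n (≮⇒≥ k≮b) ⟩
  b                             ≡⟨ m≥n⇒m⊓n≡n (m≤n⇒m≤1+n (≮⇒≥ k≮b)) ⟨
  suc k ⊓ b ∎
  where open ≡-Reasoning

∑<-χ< : ∀ k {b} → b ≤ k → ∑< k (λ a → χ< a b) ≡ b
∑<-χ< k {b} b≤k = trans (∑<-χ<-⊓ k b) (m≥n⇒m⊓n≡n b≤k)

σ-zero : ∀ x → σ 0 x ≡ x
σ-zero x with suc x ≟ 0
... | no _ with x ≟ 0
...   | yes x≡0 = sym x≡0
...   | no _    = refl

σ-left : ∀ c → σ (suc c) c ≡ suc c
σ-left c with suc c ≟ suc c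
... | yes _   = refl
... | no 1+c≢ = contradiction refl 1+c≢

σ-right : ∀ c → σ (suc c) (suc c) ≡ c
σ-right c with suc (suc c) ≟ suc c
... | yes 2+c≡ = contradiction 2+c≡ (1+n≢n)
... | no _ with suc c ≟ suc c
...   | yes _   = refl
...   | no 1+c≢ = contradiction refl 1+c≢

σ-fixed : ∀ c {x} → x ≢ c → x ≢ suc c → σ (suc c) x ≡ x
σ-fixed c {x} x≢c x≢1+c with suc x ≟ suc c
... | yes 1+x≡ = contradiction (suc-injective 1+x≡) x≢c
... | no _ with x ≟ suc c
...   | yes x≡1+c = contradiction x≡1+c x≢1+c
...   | no _      = refl

data Around (c x : ℕ) : Set where
  left  : x ≡ c → Around c x
  right : x ≡ suc c → Around c x
  apart : x ≢ c → x ≢ suc c → Around c x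

around : ∀ c x → Around c x
around c x with x ≟ c | x ≟ suc c
... | yes x≡c | _         = left x≡c
... | no _    | yes x≡1+c = right x≡1+c
... | no x≢c  | no x≢1+c  = apart x≢c x≢1+c

σ-involutive : ∀ i x → σ i (σ i x) ≡ x
σ-involutive zero    x = trans (σ-zero (σ 0 x)) (σ-zero x)
σ-involutive (suc c) x with around c x
... | left refl          = trans (cong (σ (suc c)) (σ-left c)) (σ-right c)
... | right refl         = trans (cong (σ (suc c)) (σ-right c)) (σ-left c)
... | apart x≢c x≢1+c    = trans (cong (σ (suc c)) (σ-fixed c x≢c x≢1+c)) (σ-fixed c x≢c x≢1+c)

σ-< : ∀ {i n x} → 1 ≤ i → i < n → x < n → σ i x < n
σ-< {suc c} {n} {x} _ 1+c<n x<n with around c x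
... | left refl       = subst (_< n) (sym (σ-left c)) 1+c<n
... | right refl      = subst (_< n) (sym (σ-right c)) (<-trans (n<1+n c) 1+c<n)
... | apart x≢c x≢1+c = subst (_< n) (sym (σ-fixed c x≢c x≢1+c)) x<n

χ<-σ : ∀ c {a b} → ¬ (a ≡ c × b ≡ suc c) → ¬ (a ≡ suc c × b ≡ c) →
  χ< (σ (suc c) a) (σ (suc c) b) ≡ χ< a b
χ<-σ c {a} {b} ¬ab ¬ba with around c a | around c b
... | left refl  | left refl  = cong₂ χ< (σ-left c) (σ-left c)
... | left refl  | right refl = contradiction (refl , refl) ¬ab
... | right refl | left refl  = contradiction (refl , refl) ¬ba
... | right refl | right refl = cong₂ χ< (σ-right c) (σ-right c)
... | left refl  | apart b≢c b≢1+c
  rewrite σ-left c | σ-fixed c b≢c b≢1+c = χ<-sucˡ b≢1+c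
... | right refl | apart b≢c b≢1+c
  rewrite σ-right c | σ-fixed c b≢c b≢1+c = sym (χ<-sucˡ b≢1+c)
... | apart a≢c a≢1+c | left refl
  rewrite σ-left c | σ-fixed c a≢c a≢1+c = χ<-sucʳ a≢c
... | apart a≢c a≢1+c | right refl
  rewrite σ-right c | σ-fixed c a≢c a≢1+c = sym (χ<-sucʳ a≢c)
... | apart a≢c a≢1+c | apart b≢c b≢1+c
  rewrite σ-fixed c a≢c a≢1+c | σ-fixed c b≢c b≢1+c = refl

χ<-σ-left : ∀ c a → χ< (σ (suc c) a) c ≡ χ< a c
χ<-σ-left c a with around c a
... | left refl       = trans (cong (λ x → χ< x c) (σ-left c)) (trans (χ<-0 (n≤1+n c)) (sym (χ<-0 (≤-refl {c}))))
... | right refl      = trans (cong (λ x → χ< x c) (σ-right c)) (trans (χ<-0 (≤-refl {c})) (sym (χ<-0 (n≤1+n c))))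
... | apart a≢c a≢1+c = cong (λ x → χ< x c) (σ-fixed c a≢c a≢1+c)

record InverseOn (n : ℕ) (u u⁻¹ : ℕ → ℕ) : Set where
  field
    bounded   : ∀ x → x < n → u x < n
    bounded⁻¹ : ∀ x → x < n → u⁻¹ x < n
    cancelˡ   : ∀ x → x < n → u⁻¹ (u x) ≡ x
    cancelʳ   : ∀ x → x < n → u (u⁻¹ x) ≡ x

  injective : ∀ {x y} → x < n → y < n → u x ≡ u y → x ≡ y
  injective {x} {y} x<n y<n ux≡uy = trans (sym (cancelˡ x x<n)) (trans (cong u⁻¹ ux≡uy) (cancelˡ y y<n))

  injective⁻¹ : ∀ {x y} → x < n → y < n → u⁻¹ x ≡ u⁻¹ y → x ≡ y
  injective⁻¹ {x} {y} x<n y<n e = trans (sym (cancelʳ x x<n)) (trans (cong u e) (cancelʳ y y<n))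

open InverseOn

σ∘-inverseOn : ∀ {n u u⁻¹ i} → 1 ≤ i → i < n → InverseOn n u u⁻¹ → InverseOn n (σ i ∘ u) (u⁻¹ ∘ σ i)
σ∘-inverseOn {u = u} {u⁻¹} {i} 1≤i i<n inv = record
  { bounded   = λ x x<n → σ-< 1≤i i<n (bounded inv x x<n)
  ; bounded⁻¹ = λ x x<n → bounded⁻¹ inv (σ i x) (σ-< 1≤i i<n x<n)
  ; cancelˡ   = λ x x<n → trans (cong u⁻¹ (σ-involutive i (u x))) (cancelˡ inv x x<n)
  ; cancelʳ   = λ x x<n → trans (cong (σ i) (cancelʳ inv (σ i x) (σ-< 1≤i i<n x<n))) (σ-involutive i x)
  }

act-++ : ∀ vs ws x → act (vs ++ ws) x ≡ act vs (act ws x)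
act-++ []       ws x = refl
act-++ (i ∷ vs) ws x = cong (σ i) (act-++ vs ws x)

act-reverse-cancel : ∀ ws x → act (reverse ws) (act ws x) ≡ x
act-reverse-cancel []       x = refl
act-reverse-cancel (i ∷ ws) x = begin
  act (reverse (i ∷ ws)) (σ i (act ws x)) ≡⟨ cong (λ vs → act vs (σ i (act ws x))) (unfold-reverse i ws) ⟩
  act (reverse ws ++ [ i ]) (σ i (act ws x)) ≡⟨ act-++ (reverse ws) [ i ] _ ⟩
  act (reverse ws) (σ i (σ i (act ws x))) ≡⟨ cong (act (reverse ws)) (σ-involutive i (act ws x)) ⟩
  act (reverse ws) (act ws x) ≡⟨ act-reverse-cancel ws x ⟩
  x ∎
  where open ≡-Reasoning

act-< : ∀ {n} ws → ValidWord n ws → ∀ x → x < n → act ws x < n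
act-< []       []                 x x<n = x<n
act-< (i ∷ ws) ((1≤i , i<n) ∷ ws-valid) x x<n = σ-< 1≤i i<n (act-< ws ws-valid x x<n)

reverse-valid : ∀ {n} ws → ValidWord n ws → ValidWord n (reverse ws)
reverse-valid []       []                = []
reverse-valid (i ∷ ws) (i-valid ∷ valid) =
  subst (ValidWord _) (sym (unfold-reverse i ws)) (∷ʳ⁺ (reverse-valid ws valid) i-valid)

act-inverseOn : ∀ {n} ws → ValidWord n ws → InverseOn n (act ws) (act (reverse ws))
act-inverseOn ws valid = record
  { bounded   = act-< ws valid
  ; bounded⁻¹ = act-< (reverse ws) (reverse-valid ws valid)
  ; cancelˡ   = λ x _ → act-reverse-cancel ws x
  ; cancelʳ   = λ x _ → subst (λ vs → act vs (act (reverse ws) x) ≡ x) (reverse-involutive ws)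
                                (act-reverse-cancel (reverse ws) x)
  }

WordOn : ℕ → (ℕ → ℕ) → List ℕ → Set
WordOn n u ws = ValidWord n ws × (∀ x → x < n → act ws x ≡ u x)

inversions : ℕ → (ℕ → ℕ) → ℕ
inversions n u = ∑< n (λ y → ∑< y (λ x → χ< (u y) (u x)))

inversions-cong : ∀ n {u v} → (∀ x → x < n → u x ≡ v x) → inversions n u ≡ inversions n v
inversions-cong n u≗v = ∑<-cong n (λ y y<n → ∑<-cong y (λ x x<y →
  cong₂ χ< (u≗v y y<n) (u≗v x (<-trans x<y y<n))))

inversions-id : ∀ n → inversions n (λ x → x) ≡ 0
inversions-id n = ∑<-zeros n (λ y _ → ∑<-zeros y (λ x x<y → χ<-0 (<⇒≤ x<y)))

∑<²-exchange : ∀ n (T T′ : ℕ → ℕ → ℕ) {lo hi} → lo < hi → hi < n →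
  (∀ y x → y < n → x < y → ¬ (y ≡ hi × x ≡ lo) → T y x ≡ T′ y x) →
  ∑< n (λ y → ∑< y (T y)) + T′ hi lo ≡ ∑< n (λ y → ∑< y (T′ y)) + T hi lo
∑<²-exchange n T T′ {lo} {hi} lo<hi hi<n agree = +-cancelʳ-≡ A (S + T′ hi lo) (S′ + T hi lo) (begin
  S + T′ hi lo + A      ≡⟨ +-assoc S (T′ hi lo) A ⟩
  S + (T′ hi lo + A)    ≡⟨ cong (S +_) (trans (+-comm (T′ hi lo) A) inner) ⟩
  S + (A′ + T hi lo)    ≡⟨ +-assoc S A′ (T hi lo) ⟨
  S + A′ + T hi lo      ≡⟨ cong (_+ T hi lo) outer ⟩
  S′ + A + T hi lo      ≡⟨ +-assoc S′ A (T hi lo) ⟩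
  S′ + (A + T hi lo)    ≡⟨ cong (S′ +_) (+-comm A (T hi lo)) ⟩
  S′ + (T hi lo + A)    ≡⟨ +-assoc S′ (T hi lo) A ⟨
  S′ + T hi lo + A ∎)
  where
  open ≡-Reasoning
  S = ∑< n (λ y → ∑< y (T y))
  S′ = ∑< n (λ y → ∑< y (T′ y))
  A = ∑< hi (T hi)
  A′ = ∑< hi (T′ hi)
  inner : A + T′ hi lo ≡ A′ + T hi lo
  inner = ∑<-exchange hi lo lo<hi (λ x x<hi x≢lo → agree hi x hi<n x<hi (x≢lo ∘ proj₂))
  outer : S + A′ ≡ S′ + A
  outer = ∑<-exchange n hi hi<n (λ y y<n y≢hi → ∑<-cong y (λ x x<y → agree y x y<n x<y (y≢hi ∘ proj₁)))

inversions-σ-ascent : ∀ {n u u⁻¹} c → InverseOn n u u⁻¹ → suc c < n → u⁻¹ c < u⁻¹ (suc c) →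
  inversions n (σ (suc c) ∘ u) ≡ suc (inversions n u)
inversions-σ-ascent {n} {u} {u⁻¹} c inv 1+c<n p<q = begin
  inversions n (σ (suc c) ∘ u)                             ≡⟨ +-identityʳ _ ⟨
  inversions n (σ (suc c) ∘ u) + 0                         ≡⟨ cong (inversions n (σ (suc c) ∘ u) +_) before ⟨
  inversions n (σ (suc c) ∘ u) + χ< (u q) (u p)             ≡⟨ exchange ⟨
  inversions n u + χ< (σ (suc c) (u q)) (σ (suc c) (u p))   ≡⟨ cong (inversions n u +_) after ⟩
  inversions n u + 1                                       ≡⟨ +-comm (inversions n u) 1 ⟩
  suc (inversions n u) ∎
  where
  open ≡-Reasoning
  p = u⁻¹ c
  q = u⁻¹ (suc c)
  u-p : u p ≡ c
  u-p = cancelʳ inv c (<-trans (n<1+n c) 1+c<n)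
  u-q : u q ≡ suc c
  u-q = cancelʳ inv (suc c) 1+c<n
  position : ∀ {x v} → x < n → u x ≡ v → x ≡ u⁻¹ v
  position {x} x<n ux≡v = trans (sym (cancelˡ inv x x<n)) (cong u⁻¹ ux≡v)
  agree : ∀ y x → y < n → x < y → ¬ (y ≡ q × x ≡ p) →
    χ< (u y) (u x) ≡ χ< (σ (suc c) (u y)) (σ (suc c) (u x))
  agree y x y<n x<y ¬qp = sym (χ<-σ c
    (λ (uy≡c , ux≡1+c) → <-asym x<y
      (subst₂ _<_ (sym (position y<n uy≡c)) (sym (position (<-trans x<y y<n) ux≡1+c)) p<q))
    (λ (uy≡1+c , ux≡c) → ¬qp (position y<n uy≡1+c , position (<-trans x<y y<n) ux≡c)))
  exchange : inversions n u + χ< (σ (suc c) (u q)) (σ (suc c) (u p))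
           ≡ inversions n (σ (suc c) ∘ u) + χ< (u q) (u p)
  exchange = ∑<²-exchange n _ _ p<q (bounded⁻¹ inv (suc c) 1+c<n) agree
  before : χ< (u q) (u p) ≡ 0
  before = trans (cong₂ χ< u-q u-p) (χ<-0 (n≤1+n c))
  after : χ< (σ (suc c) (u q)) (σ (suc c) (u p)) ≡ 1
  after = trans (cong₂ (λ a b → χ< (σ (suc c) a) (σ (suc c) b)) u-q u-p)
                (trans (cong₂ χ< (σ-right c) (σ-left c)) (χ<-1 (n<1+n c)))

inversions-σ-descent : ∀ {n u u⁻¹} c → InverseOn n u u⁻¹ → suc c < n → u⁻¹ (suc c) < u⁻¹ c →
  inversions n u ≡ suc (inversions n (σ (suc c) ∘ u))
inversions-σ-descent {n} {u} {u⁻¹} c inv 1+c<n q<p = begin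
  inversions n u                                    ≡⟨ inversions-cong n (λ x _ → σ-involutive (suc c) (u x)) ⟨
  inversions n (σ (suc c) ∘ σ (suc c) ∘ u)          ≡⟨ inversions-σ-ascent c (σ∘-inverseOn z<s 1+c<n inv) 1+c<n ascent ⟩
  suc (inversions n (σ (suc c) ∘ u)) ∎
  where
  open ≡-Reasoning
  ascent : u⁻¹ (σ (suc c) c) < u⁻¹ (σ (suc c) (suc c))
  ascent = subst₂ _<_ (cong u⁻¹ (sym (σ-left c))) (cong u⁻¹ (sym (σ-right c))) q<p

inversions-σ-≤ : ∀ {n u u⁻¹} c → InverseOn n u u⁻¹ → suc c < n →
  inversions n (σ (suc c) ∘ u) ≤ suc (inversions n u)
inversions-σ-≤ {n} {u} {u⁻¹} c inv 1+c<n with <-cmp (u⁻¹ c) (u⁻¹ (suc c))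
... | tri< p<q _ _ = ≤-reflexive (inversions-σ-ascent c inv 1+c<n p<q)
... | tri≈ _ p≡q _ = contradiction (injective⁻¹ inv (<-trans (n<1+n c) 1+c<n) 1+c<n p≡q) (<⇒≢ (n<1+n c))
... | tri> _ _ q<p = ≤-trans (n≤1+n _) (≤-trans (≤-reflexive (sym (inversions-σ-descent c inv 1+c<n q<p))) (n≤1+n _))

inversions-act≤length : ∀ {n} ws → ValidWord n ws → inversions n (act ws) ≤ length ws
inversions-act≤length {n} []          []                        = ≤-reflexive (inversions-id n)
inversions-act≤length (suc c ∷ ws) ((_ , 1+c<n) ∷ valid) =
  ≤-trans (inversions-σ-≤ c (act-inverseOn ws valid) 1+c<n) (s≤s (inversions-act≤length ws valid))

inversions≤length : ∀ {n u ws} → WordOn n u ws → inversions n u ≤ length ws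
inversions≤length {n} {u} {ws} (valid , ws≗u) =
  subst (_≤ length ws) (inversions-cong n ws≗u) (inversions-act≤length ws valid)

inversion⇒inversions-pos : ∀ {n u x y} → x < y → y < n → u y < u x → 0 < inversions n u
inversion⇒inversions-pos {n} {u} {x} {y} x<y y<n uy<ux = begin
  1                          ≡⟨ χ<-1 uy<ux ⟨
  χ< (u y) (u x)             ≤⟨ term≤∑< y (λ x → χ< (u y) (u x)) x<y ⟩
  ∑< y (λ x → χ< (u y) (u x)) ≤⟨ term≤∑< n (λ y → ∑< y (λ x → χ< (u y) (u x))) y<n ⟩
  inversions n u ∎
  where open ≤-Reasoning

inversions-pos⇒inversion : ∀ n u → 0 < inversions n u → ∃ λ x → ∃ λ y → x < y × y < n × u y < u x
inversions-pos⇒inversion n u pos with ∑<-pos n _ pos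
... | y , y<n , pos′ with ∑<-pos y _ pos′
...   | x , x<y , pos″ = x , y , x<y , y<n , χ<-pos pos″

Increasing : ℕ → (ℕ → ℕ) → Set
Increasing n g = ∀ {x y} → x < y → y < n → g x < g y

increasing⇒≤ : ∀ {n g} → Increasing n g → ∀ x → x < n → x ≤ g x
increasing⇒≤ g↑ zero    _     = z≤n
increasing⇒≤ g↑ (suc x) 1+x<n = ≤-trans (s≤s (increasing⇒≤ g↑ x (<-trans (n<1+n x) 1+x<n))) (g↑ (n<1+n x) 1+x<n)

increasing-inverse : ∀ {n u u⁻¹} → InverseOn n u u⁻¹ → Increasing n u → Increasing n u⁻¹
increasing-inverse {u = u} {u⁻¹} inv u↑ {x} {y} x<y y<n with <-cmp (u⁻¹ x) (u⁻¹ y)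
... | tri< lt _ _ = lt
... | tri≈ _ eq _ = contradiction (injective⁻¹ inv x<n y<n eq) (<⇒≢ x<y)
  where x<n = <-trans x<y y<n
... | tri> _ _ gt = contradiction (subst₂ _<_ (cancelʳ inv y y<n) (cancelʳ inv x x<n) (u↑ gt (bounded⁻¹ inv x x<n))) (<-asym x<y)
  where x<n = <-trans x<y y<n

inversions≡0⇒id : ∀ {n u u⁻¹} → InverseOn n u u⁻¹ → inversions n u ≡ 0 → ∀ x → x < n → u x ≡ x
inversions≡0⇒id {n} {u} {u⁻¹} inv none x x<n = ≤-antisym ux≤x (increasing⇒≤ u↑ x x<n)
  where
  u↑ : Increasing n u
  u↑ {x} {y} x<y y<n with <-cmp (u x) (u y)
  ... | tri< lt _ _ = lt
  ... | tri≈ _ eq _ = contradiction (injective inv (<-trans x<y y<n) y<n eq) (<⇒≢ x<y)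
  ... | tri> _ _ gt = contradiction (inversion⇒inversions-pos x<y y<n gt) (subst (λ m → ¬ 0 < m) (sym none) λ ())
  ux≤x : u x ≤ x
  ux≤x = subst (u x ≤_) (cancelˡ inv x x<n) (increasing⇒≤ (increasing-inverse inv u↑) (u x) (bounded inv x x<n))

descent-between : ∀ (g : ℕ → ℕ) {a b} → a < b → g b < g a → ∃ λ c → a ≤ c × c < b × g (suc c) < g c
descent-between g {a} {suc b} (s≤s a≤b) gb<ga with g (suc b) <? g b
... | yes descent = b , a≤b , ≤-refl , descent
... | no ¬descent with m≤n⇒m<n∨m≡n a≤b
...   | inj₂ refl = contradiction gb<ga ¬descent
...   | inj₁ a<b with descent-between g a<b (≤-<-trans (≮⇒≥ ¬descent) gb<ga)
...     | c , a≤c , c<b , descent = c , a≤c , m<n⇒m<1+n c<b , descent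

ReducedWordOn : ℕ → (ℕ → ℕ) → List ℕ → Set
ReducedWordOn n u ws = WordOn n u ws × length ws ≤ inversions n u

reducedWordOn-cong : ∀ {n u v ws} → (∀ x → x < n → u x ≡ v x) → ReducedWordOn n u ws → ReducedWordOn n v ws
reducedWordOn-cong {n} {ws = ws} u≗v ((valid , ws≗u) , short) =
  (valid , λ x x<n → trans (ws≗u x x<n) (u≗v x x<n)) , subst (length ws ≤_) (inversions-cong n u≗v) short

reducedWordOn-id : ∀ {n u ws} → (∀ x → x < n → u x ≡ x) → ReducedWordOn n u ws → ws ≡ []
reducedWordOn-id {n} {ws = []}    _    _               = refl
reducedWordOn-id {n} {ws = _ ∷ _} u≗id (_ , short)
  with () ← ≤-trans short (≤-reflexive (trans (inversions-cong n u≗id) (inversions-id n)))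

reducedWordOn-∷ : ∀ {n u u⁻¹ c ws} → InverseOn n u u⁻¹ → suc c < n → u⁻¹ (suc c) < u⁻¹ c →
  ReducedWordOn n (σ (suc c) ∘ u) ws → ReducedWordOn n u (suc c ∷ ws)
reducedWordOn-∷ {n} {u} {c = c} {ws} inv 1+c<n descent ((valid , ws≗σu) , short) =
  ((s≤s z≤n , 1+c<n) ∷ valid , λ x x<n → trans (cong (σ (suc c)) (ws≗σu x x<n)) (σ-involutive (suc c) (u x))) ,
  subst (suc (length ws) ≤_) (sym (inversions-σ-descent c inv 1+c<n descent)) (s≤s short)

-- The first letter of a reduced word is a descent.
reducedWordOn-uncons : ∀ {n u j ws} → ReducedWordOn n u (suc j ∷ ws) →
  act (reverse (suc j ∷ ws)) (suc j) < act (reverse (suc j ∷ ws)) j × ReducedWordOn n (σ (suc j) ∘ u) ws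
reducedWordOn-uncons {n} {u} {j} {ws} ((valid@((_ , 1+j<n) ∷ ws-valid) , word) , short)
  with <-cmp (act (reverse (suc j ∷ ws)) j) (act (reverse (suc j ∷ ws)) (suc j))
... | tri< ascent _ _ = contradiction I<I (<-irrefl refl)
  where
  open ≤-Reasoning
  I = inversions n (act (suc j ∷ ws))
  I<I : I < I
  I<I = begin-strict
    I                                         <⟨ n<1+n I ⟩
    suc I                                     ≡⟨ inversions-σ-ascent j (act-inverseOn (suc j ∷ ws) valid) 1+j<n ascent ⟨
    inversions n (σ (suc j) ∘ act (suc j ∷ ws)) ≡⟨ inversions-cong n (λ x _ → σ-involutive (suc j) (act ws x)) ⟩
    inversions n (act ws)                     ≤⟨ inversions-act≤length ws ws-valid ⟩
    length ws                                 ≤⟨ n≤1+n (length ws) ⟩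
    length (suc j ∷ ws)                       ≤⟨ short ⟩
    inversions n u                            ≡⟨ inversions-cong n word ⟨
    I ∎
... | tri≈ _ eq _ =
  contradiction (injective⁻¹ (act-inverseOn (suc j ∷ ws) valid) (<-trans (n<1+n j) 1+j<n) 1+j<n eq) (<⇒≢ (n<1+n j))
... | tri> _ _ descent = descent , ((ws-valid , ws≗σu) , ≤-pred (≤-trans short (≤-reflexive (begin
  inversions n u                              ≡⟨ inversions-cong n word ⟨
  inversions n (act (suc j ∷ ws))              ≡⟨ inversions-σ-descent j (act-inverseOn (suc j ∷ ws) valid) 1+j<n descent ⟩
  suc (inversions n (σ (suc j) ∘ act (suc j ∷ ws))) ≡⟨ cong suc (inversions-cong n (λ x x<n → cong (σ (suc j)) (word x x<n))) ⟩
  suc (inversions n (σ (suc j) ∘ u)) ∎))))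
  where
  open ≡-Reasoning
  ws≗σu : ∀ x → x < n → act ws x ≡ σ (suc j) (u x)
  ws≗σu x x<n = trans (sym (σ-involutive (suc j) (act ws x))) (cong (σ (suc j)) (word x x<n))

-- An occurrence of a pattern of length k at the positions F 0 < ⋯ < F (k − 1); flatten u is
-- the permutation of [0, k) in the same relative order as u ∘ F.
module Pattern {n k : ℕ} (F : ℕ → ℕ) (F-< : ∀ a → a < k → F a < n) (F-mono : Increasing k F) where

  F-reflects-< : ∀ {a b} → a < k → F a < F b → a < b
  F-reflects-< {a} {b} a<k Fa<Fb with <-cmp a b
  ... | tri< a<b _ _ = a<b
  ... | tri≈ _ refl _ = contradiction Fa<Fb (<-irrefl refl)
  ... | tri> _ _ b<a = contradiction (F-mono b<a a<k) (<-asym Fa<Fb)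

  uF-injective : ∀ {u u⁻¹ a b} → InverseOn n u u⁻¹ → a < k → b < k → u (F a) ≡ u (F b) → a ≡ b
  uF-injective {a = a} {b} inv a<k b<k e with <-cmp a b
  ... | tri< a<b _ _ = contradiction (injective inv (F-< a a<k) (F-< b b<k) e) (<⇒≢ (F-mono a<b b<k))
  ... | tri≈ _ a≡b _ = a≡b
  ... | tri> _ _ b<a = contradiction (injective inv (F-< a a<k) (F-< b b<k) e) (>⇒≢ (F-mono b<a a<k))

  rank : (ℕ → ℕ) → ℕ → ℕ
  rank u y = ∑< k (λ b → χ< (u (F b)) y)

  flatten : (ℕ → ℕ) → ℕ → ℕ
  flatten u a = rank u (u (F a))

  flatten-cong : ∀ {u v} → (∀ x → x < n → u x ≡ v x) → ∀ a → a < k → flatten u a ≡ flatten v a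
  flatten-cong u≗v a a<k = ∑<-cong k (λ b b<k → cong₂ χ< (u≗v (F b) (F-< b b<k)) (u≗v (F a) (F-< a a<k)))

  flatten-mono-≤ : ∀ u {a b} → u (F b) ≤ u (F a) → flatten u b ≤ flatten u a
  flatten-mono-≤ u ub≤ua = ∑<-mono-≤ k (λ c _ → χ<-monoʳ-≤ (u (F c)) ub≤ua)

  flatten-mono-< : ∀ u {a b} → b < k → u (F b) < u (F a) → flatten u b < flatten u a
  flatten-mono-< u {a} {b} b<k ub<ua = ∑<-mono-< k b b<k
    (subst₂ _<_ (sym (χ<-0 (≤-refl {u (F b)}))) (sym (χ<-1 ub<ua)) z<s)
    (λ c _ → χ<-monoʳ-≤ (u (F c)) (<⇒≤ ub<ua))

  flatten-reflects-< : ∀ u {a b} → a < k → flatten u b < flatten u a → u (F b) < u (F a)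
  flatten-reflects-< u {a} {b} a<k fb<fa with <-cmp (u (F b)) (u (F a))
  ... | tri< lt _ _ = lt
  ... | tri≈ _ eq _ = contradiction (cong (rank u) eq) (<⇒≢ fb<fa)
  ... | tri> _ _ gt = contradiction (flatten-mono-< u a<k gt) (<-asym fb<fa)

  flatten-injective : ∀ {u u⁻¹ a b} → InverseOn n u u⁻¹ → a < k → b < k → flatten u a ≡ flatten u b → a ≡ b
  flatten-injective {u} inv a<k b<k e with <-cmp (u (F _)) (u (F _))
  ... | tri< lt _ _ = contradiction e (<⇒≢ (flatten-mono-< u a<k lt))
  ... | tri≈ _ eq _ = uF-injective inv a<k b<k eq
  ... | tri> _ _ gt = contradiction e (>⇒≢ (flatten-mono-< u b<k gt))

  flatten-id : ∀ {u} → (∀ x → x < n → u x ≡ x) → ∀ a → a < k → flatten u a ≡ a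
  flatten-id {u} u≗id a a<k = trans (∑<-cong k term) (∑<-χ< k (<⇒≤ a<k))
    where
    term : ∀ b → b < k → χ< (u (F b)) (u (F a)) ≡ χ< b a
    term b b<k = trans (cong₂ χ< (u≗id (F b) (F-< b b<k)) (u≗id (F a) (F-< a a<k)))
                       (χ<-cong-⇔ (F-reflects-< b<k) (λ b<a → F-mono b<a a<k))

  flatten-orderIso : ∀ {u} (π : Permutation′ k) →
    (∀ i j → u (F (toℕ i)) < u (F (toℕ j)) → π ⟨$⟩ʳ i Fin.< π ⟨$⟩ʳ j) →
    (∀ i j → π ⟨$⟩ʳ i Fin.< π ⟨$⟩ʳ j → u (F (toℕ i)) < u (F (toℕ j))) →
    ∀ i → flatten u (toℕ i) ≡ toℕ (π ⟨$⟩ʳ i)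
  flatten-orderIso {u} π to from i = begin
    flatten u (toℕ i)                                    ≡⟨ ∑<≡sum k (λ b → χ< (u (F b)) (u (F (toℕ i)))) ⟩
    sum {k} (λ j → χ< (u (F (toℕ j))) (u (F (toℕ i))))    ≡⟨ sum-cong-≗ {k} (λ j → χ<-cong-⇔ (to j i) (from j i)) ⟩
    sum {k} (λ j → χ< (toℕ (π ⟨$⟩ʳ j)) (toℕ (π ⟨$⟩ʳ i)))  ≡⟨ sum-permute (λ j → χ< (toℕ j) (toℕ (π ⟨$⟩ʳ i))) π ⟨
    sum {k} (λ j → χ< (toℕ j) (toℕ (π ⟨$⟩ʳ i)))           ≡⟨ ∑<≡sum k (λ b → χ< b (toℕ (π ⟨$⟩ʳ i))) ⟨
    ∑< k (λ b → χ< b (toℕ (π ⟨$⟩ʳ i)))                    ≡⟨ ∑<-χ< k (toℕ≤n (π ⟨$⟩ʳ i)) ⟩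
    toℕ (π ⟨$⟩ʳ i) ∎
    where open ≡-Reasoning

  rank-suc : ∀ {u u⁻¹ a y} → InverseOn n u u⁻¹ → a < k → u (F a) ≡ y → rank u (suc y) ≡ suc (rank u y)
  rank-suc {u} {a = a} {y} inv a<k ua≡y = begin
    rank u (suc y)                   ≡⟨ +-identityʳ _ ⟨
    rank u (suc y) + 0               ≡⟨ cong (rank u (suc y) +_) (trans (cong (λ x → χ< x y) ua≡y) (χ<-0 (≤-refl {y}))) ⟨
    rank u (suc y) + χ< (u (F a)) y  ≡⟨ ∑<-exchange k a a<k agree ⟨
    rank u y + χ< (u (F a)) (suc y)  ≡⟨ cong (rank u y +_) (trans (cong (λ x → χ< x (suc y)) ua≡y) (χ<-1 (n<1+n y))) ⟩
    rank u y + 1                     ≡⟨ +-comm (rank u y) 1 ⟩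
    suc (rank u y) ∎
    where
    open ≡-Reasoning
    agree : ∀ b → b < k → b ≢ a → χ< (u (F b)) y ≡ χ< (u (F b)) (suc y)
    agree b b<k b≢a = sym (χ<-sucʳ (λ ub≡y → b≢a (uF-injective inv b<k a<k (trans ub≡y (sym ua≡y)))))

  PatternValue : (ℕ → ℕ) → ℕ → Set
  PatternValue u y = ∃ λ b → b < k × u (F b) ≡ y

  PatternPair : (ℕ → ℕ) → ℕ → Set
  PatternPair u c = PatternValue u c × PatternValue u (suc c)

  patternPair? : ∀ u c → Dec (PatternPair u c)
  patternPair? u c = anyUpTo? (λ b → u (F b) ≟ c) k ×-dec anyUpTo? (λ b → u (F b) ≟ suc c) k

  patternPair-σ : ∀ {u v} c → (∀ x → x < n → v x ≡ σ (suc c) (u x)) → PatternPair v c → PatternPair u c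
  patternPair-σ {u} {v} c v≗σu ((b₀ , b₀<k , vb₀≡c) , (b₁ , b₁<k , vb₁≡1+c)) =
    (b₁ , b₁<k , trans (u≡σv b₁ b₁<k) (trans (cong (σ (suc c)) vb₁≡1+c) (σ-right c))) ,
    (b₀ , b₀<k , trans (u≡σv b₀ b₀<k) (trans (cong (σ (suc c)) vb₀≡c) (σ-left c)))
    where
    u≡σv : ∀ b → b < k → u (F b) ≡ σ (suc c) (v (F b))
    u≡σv b b<k = trans (sym (σ-involutive (suc c) (u (F b)))) (cong (σ (suc c)) (sym (v≗σu (F b) (F-< b b<k))))

  flatten-σ : ∀ u c a → (∀ b → b < k → ¬ (u (F b) ≡ c × u (F a) ≡ suc c) × ¬ (u (F b) ≡ suc c × u (F a) ≡ c)) →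
    flatten (σ (suc c) ∘ u) a ≡ flatten u a
  flatten-σ u c a avoid = ∑<-cong k (λ b b<k → χ<-σ c (proj₁ (avoid b b<k)) (proj₂ (avoid b b<k)))

  flatten-σ-free : ∀ {u c} → ¬ PatternPair u c → ∀ a → a < k → flatten (σ (suc c) ∘ u) a ≡ flatten u a
  flatten-σ-free {u} {c} ¬pair a a<k = flatten-σ u c a (λ b b<k →
    (λ (ub≡c , ua≡1+c) → ¬pair ((b , b<k , ub≡c) , (a , a<k , ua≡1+c))) ,
    (λ (ub≡1+c , ua≡c) → ¬pair ((a , a<k , ua≡c) , (b , b<k , ub≡1+c))))

  consecutive-squeeze : ∀ {u u⁻¹ a₀ a₁ b₀ b₁} → InverseOn n u u⁻¹ → a₀ < k → a₁ < k → b₀ < k → b₁ < k →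
    flatten u a₁ ≡ suc (flatten u a₀) → u (F a₀) ≤ u (F b₀) → u (F b₀) < u (F b₁) → u (F b₁) ≤ u (F a₁) →
    b₀ ≡ a₀ × b₁ ≡ a₁
  consecutive-squeeze {u} {a₀ = a₀} {a₁} {b₀} {b₁} inv a₀<k a₁<k b₀<k b₁<k consecutive a₀≤b₀ b₀<b₁ b₁≤a₁ =
    flatten-injective inv b₀<k a₀<k (≤-antisym b₀≤a₀ (flatten-mono-≤ u a₀≤b₀)) ,
    flatten-injective inv b₁<k a₁<k (≤-antisym (flatten-mono-≤ u b₁≤a₁) a₁≤b₁)
    where
    fb₀<fb₁ : flatten u b₀ < flatten u b₁
    fb₀<fb₁ = flatten-mono-< u b₀<k b₀<b₁
    b₀≤a₀ : flatten u b₀ ≤ flatten u a₀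
    b₀≤a₀ = ≤-pred (≤-trans fb₀<fb₁ (≤-trans (flatten-mono-≤ u b₁≤a₁) (≤-reflexive consecutive)))
    a₁≤b₁ : flatten u a₁ ≤ flatten u b₁
    a₁≤b₁ = ≤-trans (≤-reflexive consecutive) (≤-trans (s≤s (flatten-mono-≤ u a₀≤b₀)) fb₀<fb₁)

  module _ {u u⁻¹} (inv : InverseOn n u u⁻¹) {c a₀ a₁} (a₀<k : a₀ < k) (a₁<k : a₁ < k)
           (ua₀≡c : u (F a₀) ≡ c) (ua₁≡1+c : u (F a₁) ≡ suc c) where

    open ≡-Reasoning

    flatten-consecutive : flatten u a₁ ≡ suc (flatten u a₀)
    flatten-consecutive = begin
      rank u (u (F a₁))    ≡⟨ cong (rank u) ua₁≡1+c ⟩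
      rank u (suc c)       ≡⟨ rank-suc inv a₀<k ua₀≡c ⟩
      suc (rank u c)       ≡⟨ cong (suc ∘ rank u) ua₀≡c ⟨
      suc (flatten u a₀) ∎

    private
      σu = σ (suc c) ∘ u
      σu-inv : InverseOn n σu (u⁻¹ ∘ σ (suc c))
      σu-inv = σ∘-inverseOn z<s (subst (_< n) ua₁≡1+c (bounded inv (F a₁) (F-< a₁ a₁<k))) inv
      σua₁≡c : σu (F a₁) ≡ c
      σua₁≡c = trans (cong (σ (suc c)) ua₁≡1+c) (σ-right c)
      rank-σu-c : rank σu c ≡ flatten u a₀
      rank-σu-c = trans (∑<-cong k (λ b _ → χ<-σ-left c (u (F b)))) (cong (rank u) (sym ua₀≡c))

    flatten-σ-pair : ∀ a → a < k → flatten (σ (suc c) ∘ u) a ≡ σ (suc (flatten u a₀)) (flatten u a)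
    flatten-σ-pair a a<k with a ≟ a₀ | a ≟ a₁
    ... | yes refl | _ = begin
      rank σu (σu (F a₀))  ≡⟨ cong (rank σu) (trans (cong (σ (suc c)) ua₀≡c) (σ-left c)) ⟩
      rank σu (suc c)      ≡⟨ rank-suc σu-inv a₁<k σua₁≡c ⟩
      suc (rank σu c)      ≡⟨ cong suc rank-σu-c ⟩
      suc (flatten u a₀)   ≡⟨ σ-left (flatten u a₀) ⟨
      σ (suc (flatten u a₀)) (flatten u a₀) ∎
    ... | no _ | yes refl = begin
      rank σu (σu (F a₁))  ≡⟨ cong (rank σu) σua₁≡c ⟩
      rank σu c            ≡⟨ rank-σu-c ⟩
      flatten u a₀         ≡⟨ σ-right (flatten u a₀) ⟨
      σ (suc (flatten u a₀)) (suc (flatten u a₀)) ≡⟨ cong (σ (suc (flatten u a₀))) flatten-consecutive ⟨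
      σ (suc (flatten u a₀)) (flatten u a₁) ∎
    ... | no a≢a₀ | no a≢a₁ = begin
      flatten σu a                         ≡⟨ flatten-σ u c a (λ _ _ → (a≢a₁ ∘ at a₁<k ua₁≡1+c ∘ proj₂) ,
                                                                  (a≢a₀ ∘ at a₀<k ua₀≡c ∘ proj₂)) ⟩
      flatten u a                          ≡⟨ σ-fixed (flatten u a₀) (a≢a₀ ∘ flatten-injective inv a<k a₀<k)
                                                (a≢a₁ ∘ flatten-injective inv a<k a₁<k ∘ λ e → trans e (sym flatten-consecutive)) ⟨
      σ (suc (flatten u a₀)) (flatten u a) ∎
      where
      at : ∀ {b y} → b < k → u (F b) ≡ y → u (F a) ≡ y → a ≡ b
      at b<k ub≡y ua≡y = uF-injective inv a<k b<k (trans ua≡y (sym ub≡y))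

  -- The surviving letters are renamed to the letters of 𝔖ₖ swapping the corresponding flattened values.
  restrict : List ℕ → List ℕ
  restrict []           = []
  restrict (zero ∷ ws)  = restrict ws
  restrict (suc c ∷ ws) with patternPair? (act ws) c
  ... | yes _ = rank (act ws) (suc c) ∷ restrict ws
  ... | no _  = restrict ws

  restrict-drop : ∀ c ws → ¬ PatternPair (act ws) c → restrict (suc c ∷ ws) ≡ restrict ws
  restrict-drop c ws ¬pair with patternPair? (act ws) c
  ... | yes pair = contradiction pair ¬pair
  ... | no _     = refl

  restrict-keep : ∀ c ws → PatternPair (act ws) c → restrict (suc c ∷ ws) ≡ rank (act ws) (suc c) ∷ restrict ws
  restrict-keep c ws pair with patternPair? (act ws) c
  ... | yes _     = refl
  ... | no ¬pair  = contradiction pair ¬pair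

  Lifts : (ℕ → ℕ) → List ℕ → Set
  Lifts u v = ∃ λ ws → ReducedWordOn n u ws × restrict ws ≡ v

  lift-free : ∀ {u u⁻¹ c v} → InverseOn n u u⁻¹ → suc c < n → u⁻¹ (suc c) < u⁻¹ c → ¬ PatternPair u c →
    Lifts (σ (suc c) ∘ u) v → Lifts u v
  lift-free {u} {c = c} inv 1+c<n descent ¬pair (ws , ws-red@((_ , ws≗σu) , _) , restrict-ws) =
    suc c ∷ ws , reducedWordOn-∷ inv 1+c<n descent ws-red ,
    trans (restrict-drop c ws (¬pair ∘ patternPair-σ {u} c ws≗σu)) restrict-ws

  lift-pair : ∀ {u u⁻¹ c a₀ a₁ v} → InverseOn n u u⁻¹ → suc c < n → u⁻¹ (suc c) < u⁻¹ c →
    a₀ < k → a₁ < k → u (F a₀) ≡ c → u (F a₁) ≡ suc c →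
    Lifts (σ (suc c) ∘ u) v → Lifts u (suc (flatten u a₀) ∷ v)
  lift-pair {u} {c = c} {a₀} {a₁} inv 1+c<n descent a₀<k a₁<k ua₀≡c ua₁≡1+c (ws , ws-red@((_ , ws≗σu) , _) , restrict-ws) =
    suc c ∷ ws , reducedWordOn-∷ inv 1+c<n descent ws-red ,
    trans (restrict-keep c ws ((a₁ , a₁<k , ws-a₁) , (a₀ , a₀<k , ws-a₀))) (cong₂ _∷_ letter restrict-ws)
    where
    open ≡-Reasoning
    ws-a₀ : act ws (F a₀) ≡ suc c
    ws-a₀ = trans (ws≗σu (F a₀) (F-< a₀ a₀<k)) (trans (cong (σ (suc c)) ua₀≡c) (σ-left c))
    ws-a₁ : act ws (F a₁) ≡ c
    ws-a₁ = trans (ws≗σu (F a₁) (F-< a₁ a₁<k)) (trans (cong (σ (suc c)) ua₁≡1+c) (σ-right c))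
    letter : rank (act ws) (suc c) ≡ suc (flatten u a₀)
    letter = begin
      rank (act ws) (suc c)                 ≡⟨ cong (rank (act ws)) ws-a₀ ⟨
      flatten (act ws) a₀                   ≡⟨ flatten-cong ws≗σu a₀ a₀<k ⟩
      flatten (σ (suc c) ∘ u) a₀            ≡⟨ flatten-σ-pair inv a₀<k a₁<k ua₀≡c ua₁≡1+c a₀ a₀<k ⟩
      σ (suc (flatten u a₀)) (flatten u a₀) ≡⟨ σ-left (flatten u a₀) ⟩
      suc (flatten u a₀) ∎

  -- A descent of u at which a lift of v can be continued: it either swaps two values not both in
  -- the pattern, or it swaps the pattern values that the first letter of v swaps in the flattening.
  data NextLetter (u u⁻¹ : ℕ → ℕ) (v : List ℕ) : Set where
    free   : ∀ c → suc c < n → u⁻¹ (suc c) < u⁻¹ c → ¬ PatternPair u c → NextLetter u u⁻¹ v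
    paired : ∀ c {a₀ a₁ v′} → suc c < n → u⁻¹ (suc c) < u⁻¹ c → a₀ < k → a₁ < k →
             u (F a₀) ≡ c → u (F a₁) ≡ suc c → v ≡ suc (flatten u a₀) ∷ v′ → NextLetter u u⁻¹ v

  next-letter-empty : ∀ {u u⁻¹} → InverseOn n u u⁻¹ → 0 < inversions n u → (∀ a → a < k → a ≡ flatten u a) →
    NextLetter u u⁻¹ []
  next-letter-empty {u} {u⁻¹} inv pos id≗flat with inversions-pos⇒inversion n u pos
  ... | x , y , x<y , y<n , uy<ux
    with descent-between u⁻¹ uy<ux (subst₂ _<_ (sym (cancelˡ inv x (<-trans x<y y<n))) (sym (cancelˡ inv y y<n)) x<y)
  ...   | c , _ , c<ux , descent = free c (≤-<-trans c<ux (bounded inv x (<-trans x<y y<n))) descent ¬pair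
    where
    -- The flattening is the identity, so every pattern pair is an ascent of u.
    ¬pair : ¬ PatternPair u c
    ¬pair ((b₀ , b₀<k , ub₀≡c) , (b₁ , b₁<k , ub₁≡1+c)) = <-asym (F-mono b₀<b₁ b₁<k) Fb₁<Fb₀
      where
      b₀<b₁ : b₀ < b₁
      b₀<b₁ = subst₂ _<_ (sym (id≗flat b₀ b₀<k)) (sym (id≗flat b₁ b₁<k))
                (flatten-mono-< u b₀<k (subst₂ _<_ (sym ub₀≡c) (sym ub₁≡1+c) (n<1+n c)))
      Fb₁<Fb₀ : F b₁ < F b₀
      Fb₁<Fb₀ = subst₂ _<_ (trans (cong u⁻¹ (sym ub₁≡1+c)) (cancelˡ inv (F b₁) (F-< b₁ b₁<k)))
                           (trans (cong u⁻¹ (sym ub₀≡c)) (cancelˡ inv (F b₀) (F-< b₀ b₀<k))) descent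
  next-letter-cons : ∀ {u u⁻¹ j v′} → InverseOn n u u⁻¹ → ReducedWordOn k (flatten u) (suc j ∷ v′) →
    NextLetter u u⁻¹ (suc j ∷ v′)
  next-letter-cons {u} {u⁻¹} {j} {v′} inv v-red@((valid@((_ , 1+j<k) ∷ _) , v≗flat) , _) =
    choose (u (F a₁) ≟ suc (u (F a₀)))
    where
    V = suc j ∷ v′
    V-inv = act-inverseOn V valid
    a₀ = act (reverse V) j
    a₁ = act (reverse V) (suc j)
    a₀<k : a₀ < k
    a₀<k = bounded⁻¹ V-inv j (<-trans (n<1+n j) 1+j<k)
    a₁<k : a₁ < k
    a₁<k = bounded⁻¹ V-inv (suc j) 1+j<k
    flat-a₀ : flatten u a₀ ≡ j
    flat-a₀ = trans (sym (v≗flat a₀ a₀<k)) (cancelʳ V-inv j (<-trans (n<1+n j) 1+j<k))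
    flat-a₁ : flatten u a₁ ≡ suc j
    flat-a₁ = trans (sym (v≗flat a₁ a₁<k)) (cancelʳ V-inv (suc j) 1+j<k)
    consecutive : flatten u a₁ ≡ suc (flatten u a₀)
    consecutive = trans flat-a₁ (cong suc (sym flat-a₀))
    x₀<x₁ : u (F a₀) < u (F a₁)
    x₀<x₁ = flatten-reflects-< u a₁<k (subst₂ _<_ (sym flat-a₀) (sym flat-a₁) (n<1+n j))
    x₁<n : u (F a₁) < n
    x₁<n = bounded inv (F a₁) (F-< a₁ a₁<k)
    inverted : u⁻¹ (u (F a₁)) < u⁻¹ (u (F a₀))
    inverted = subst₂ _<_ (sym (cancelˡ inv (F a₁) (F-< a₁ a₁<k))) (sym (cancelˡ inv (F a₀) (F-< a₀ a₀<k)))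
                 (F-mono (proj₁ (reducedWordOn-uncons v-red)) a₀<k)
    choose : Dec (u (F a₁) ≡ suc (u (F a₀))) → NextLetter u u⁻¹ V
    choose (yes adjacent) =
      paired (u (F a₀)) (subst (_< n) adjacent x₁<n) (subst (λ x → u⁻¹ x < u⁻¹ (u (F a₀))) adjacent inverted)
             a₀<k a₁<k refl adjacent (cong (λ i → suc i ∷ v′) (sym flat-a₀))
    choose (no ¬adjacent) with descent-between u⁻¹ x₀<x₁ inverted
    ... | c , x₀≤c , c<x₁ , descent = free c (≤-<-trans c<x₁ x₁<n) descent ¬pair
      where
      ¬pair : ¬ PatternPair u c
      ¬pair ((b₀ , b₀<k , ub₀≡c) , (b₁ , b₁<k , ub₁≡1+c))
        with consecutive-squeeze inv a₀<k a₁<k b₀<k b₁<k consecutive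
               (subst (u (F a₀) ≤_) (sym ub₀≡c) x₀≤c)
               (subst₂ _<_ (sym ub₀≡c) (sym ub₁≡1+c) (n<1+n c))
               (subst (_≤ u (F a₁)) (sym ub₁≡1+c) c<x₁)
      ... | refl , refl = ¬adjacent (trans ub₁≡1+c (cong suc (sym ub₀≡c)))

  next-letter : ∀ {u u⁻¹ v} → InverseOn n u u⁻¹ → 0 < inversions n u → ReducedWordOn k (flatten u) v →
    NextLetter u u⁻¹ v
  next-letter {v = []}        inv pos ((_ , id≗flat) , _) = next-letter-empty inv pos id≗flat
  next-letter {v = suc _ ∷ _} inv _   v-red               = next-letter-cons inv v-red
  next-letter {v = zero ∷ _}  _   _   (((() , _) ∷ _ , _) , _)

  lifts : ∀ m {u u⁻¹ v} → InverseOn n u u⁻¹ → inversions n u ≡ m → ReducedWordOn k (flatten u) v → Lifts u v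
  lifts zero {u} inv none v-red
    rewrite reducedWordOn-id (flatten-id (inversions≡0⇒id inv none)) v-red =
    [] , (([] , λ x x<n → sym (inversions≡0⇒id inv none x x<n)) , z≤n) , refl
  lifts (suc m) {u} {u⁻¹} {v} inv count v-red = continue (next-letter inv (subst (0 <_) (sym count) z<s) v-red)
    where
    lifts-σ : ∀ {c v} → suc c < n → u⁻¹ (suc c) < u⁻¹ c →
      ReducedWordOn k (flatten (σ (suc c) ∘ u)) v → Lifts (σ (suc c) ∘ u) v
    lifts-σ {c} 1+c<n descent = lifts m (σ∘-inverseOn z<s 1+c<n inv)
      (suc-injective (trans (sym (inversions-σ-descent c inv 1+c<n descent)) count))
    continue : NextLetter u u⁻¹ v → Lifts u v
    continue (free c 1+c<n descent ¬pair) =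
      lift-free inv 1+c<n descent ¬pair
        (lifts-σ 1+c<n descent (reducedWordOn-cong (λ a a<k → sym (flatten-σ-free {u} ¬pair a a<k)) v-red))
    continue (paired c 1+c<n descent a₀<k a₁<k ua₀≡c ua₁≡1+c v≡) =
      subst (Lifts u) (sym v≡) (lift-pair inv 1+c<n descent a₀<k a₁<k ua₀≡c ua₁≡1+c
        (lifts-σ 1+c<n descent (reducedWordOn-cong (λ a a<k → sym (flatten-σ-pair inv a₀<k a₁<k ua₀≡c ua₁≡1+c a a<k))
          (proj₂ (reducedWordOn-uncons (subst (ReducedWordOn k (flatten u)) v≡ v-red))))))

-- Values outside [0, k) are never used.
extend : ∀ {k n} → (Fin k → Fin n) → ℕ → ℕ
extend {k} g x with x <? k
... | yes x<k = toℕ (g (fromℕ< x<k))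
... | no _    = x

extend-toℕ : ∀ {k n} (g : Fin k → Fin n) i → extend g (toℕ i) ≡ toℕ (g i)
extend-toℕ {k} g i with toℕ i <? k
... | yes i<k = cong (toℕ ∘ g) (fromℕ<-toℕ i i<k)
... | no i≮k  = contradiction (toℕ<n i) i≮k

extend-fromℕ< : ∀ {k n} (g : Fin k → Fin n) {x} (x<k : x < k) → extend g x ≡ toℕ (g (fromℕ< x<k))
extend-fromℕ< g x<k = trans (cong (extend g) (sym (toℕ-fromℕ< x<k))) (extend-toℕ g (fromℕ< x<k))

∀Fin⇒∀< : ∀ {k} {P : ℕ → Set} → (∀ (i : Fin k) → P (toℕ i)) → ∀ x → x < k → P x
∀Fin⇒∀< {P = P} h x x<k = subst P (toℕ-fromℕ< x<k) (h (fromℕ< x<k))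

extend-< : ∀ {k n} (g : Fin k → Fin n) x → x < k → extend g x < n
extend-< {n = n} g = ∀Fin⇒∀< (λ i → subst (_< n) (sym (extend-toℕ g i)) (toℕ<n (g i)))

extend-inverseOn : ∀ {n} (π : Permutation′ n) → InverseOn n (extend (π ⟨$⟩ʳ_)) (extend (π ⟨$⟩ˡ_))
extend-inverseOn π = record
  { bounded   = extend-< (π ⟨$⟩ʳ_)
  ; bounded⁻¹ = extend-< (π ⟨$⟩ˡ_)
  ; cancelˡ   = ∀Fin⇒∀< (λ i → trans (cong (extend (π ⟨$⟩ˡ_)) (extend-toℕ (π ⟨$⟩ʳ_) i))
                                     (trans (extend-toℕ (π ⟨$⟩ˡ_) (π ⟨$⟩ʳ i)) (cong toℕ (inverseˡ π))))
  ; cancelʳ   = ∀Fin⇒∀< (λ i → trans (cong (extend (π ⟨$⟩ʳ_)) (extend-toℕ (π ⟨$⟩ˡ_) i))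
                                     (trans (extend-toℕ (π ⟨$⟩ʳ_) (π ⟨$⟩ˡ i)) (cong toℕ (inverseʳ π))))
  }

isWord⇒wordOn : ∀ {n w ws} → IsWord n w ws → WordOn n (extend (w ⟨$⟩ʳ_)) ws
isWord⇒wordOn {w = w} (valid , word) = valid , ∀Fin⇒∀< (λ i → trans (word i) (sym (extend-toℕ (w ⟨$⟩ʳ_) i)))

wordOn⇒isWord : ∀ {n w ws} → WordOn n (extend (w ⟨$⟩ʳ_)) ws → IsWord n w ws
wordOn⇒isWord {w = w} (valid , word) = valid , λ i → trans (word (toℕ i) (toℕ<n i)) (extend-toℕ (w ⟨$⟩ʳ_) i)

-- Bubble sort, as the lift of the empty pattern.
shortest-word : ∀ {n u u⁻¹} → InverseOn n u u⁻¹ → ∃ (ReducedWordOn n u)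
shortest-word {n} inv with lifts _ inv refl (([] , λ _ ()) , z≤n)
  where open Pattern {n} {0} (λ _ → 0) (λ _ ()) (λ _ ())
... | ws , ws-red , _ = ws , ws-red

isReduced⇒reducedWordOn : ∀ {n w ws} → IsReduced n w ws → ReducedWordOn n (extend (w ⟨$⟩ʳ_)) ws
isReduced⇒reducedWordOn {w = w} (ws-word , minimal) with shortest-word (extend-inverseOn w)
... | vs , vs-word , vs-short = isWord⇒wordOn {w = w} ws-word , ≤-trans (minimal vs (wordOn⇒isWord {w = w} vs-word)) vs-short

reducedWordOn⇒isReduced : ∀ {n w ws} → ReducedWordOn n (extend (w ⟨$⟩ʳ_)) ws → IsReduced n w ws
reducedWordOn⇒isReduced {w = w} (ws-word , short) =
  wordOn⇒isWord {w = w} ws-word , λ vs vs-word → ≤-trans short (inversions≤length (isWord⇒wordOn {w = w} vs-word))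

Unique-⊆⇒length-≤ : ∀ {A : Set} {xs ys : List A} → Unique xs → (∀ {x} → x ∈ xs → x ∈ ys) → length xs ≤ length ys
Unique-⊆⇒length-≤ {xs = []}     _                   _  = z≤n
Unique-⊆⇒length-≤ {xs = x ∷ xs} (x∉xs ∷ xs-unique) xs⊆ys with ∈-∃++ (xs⊆ys (here refl))
... | ys₁ , ys₂ , refl =
  subst (suc (length xs) ≤_) (sym (length-++-sucʳ ys₁ x ys₂)) (s≤s (Unique-⊆⇒length-≤ xs-unique xs⊆ys₁++ys₂))
  where
  xs⊆ys₁++ys₂ : ∀ {z} → z ∈ xs → z ∈ ys₁ ++ ys₂
  xs⊆ys₁++ys₂ {z} z∈xs with ∈-++⁻ ys₁ (xs⊆ys (there z∈xs))
  ... | inj₁ z∈ys₁         = ∈-++⁺ˡ z∈ys₁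
  ... | inj₂ (here z≡x)    = contradiction (sym z≡x) (lookup x∉xs z∈xs)
  ... | inj₂ (there z∈ys₂) = ∈-++⁺ʳ ys₁ z∈ys₂

module Occurrence {k n} {p : Permutation′ k} {w : Permutation′ n} (p≺w : Contains p w) where

  private
    f = proj₁ p≺w
    f-mono = proj₁ (proj₂ p≺w)
    f-iso = proj₂ (proj₂ p≺w)
    W = extend (w ⟨$⟩ʳ_)

  F-mono : Increasing k (extend f)
  F-mono {x} {y} x<y y<k =
    subst₂ _<_ (sym (extend-fromℕ< f (<-trans x<y y<k))) (sym (extend-fromℕ< f y<k))
      (f-mono _ _ (subst₂ _<_ (sym (toℕ-fromℕ< (<-trans x<y y<k))) (sym (toℕ-fromℕ< y<k)) x<y))

  open Pattern (extend f) (extend-< f) F-mono public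

  flatten-w : ∀ i → flatten W (toℕ i) ≡ toℕ (p ⟨$⟩ʳ i)
  flatten-w = flatten-orderIso {W} p
    (λ i j lt → proj₂ (f-iso i j) (subst₂ _<_ (WF i) (WF j) lt))
    (λ i j lt → subst₂ _<_ (sym (WF i)) (sym (WF j)) (proj₁ (f-iso i j) lt))
    where
    WF : ∀ i → W (extend f (toℕ i)) ≡ toℕ (w ⟨$⟩ʳ (f i))
    WF i = trans (cong W (extend-toℕ f i)) (extend-toℕ (w ⟨$⟩ʳ_) (f i))

  restrict-covers : ∀ {v} → IsReduced k p v → ∃ λ ws → IsReduced n w ws × restrict ws ≡ v
  restrict-covers v-red with lifts _ (extend-inverseOn w) refl (reducedWordOn-cong p≗flat (isReduced⇒reducedWordOn {w = p} v-red))
    where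
    p≗flat : ∀ a → a < k → extend (p ⟨$⟩ʳ_) a ≡ flatten W a
    p≗flat = ∀Fin⇒∀< (λ i → trans (extend-toℕ (p ⟨$⟩ʳ_) i) (sym (flatten-w i)))
  ... | ws , ws-red , restrict-ws = ws , reducedWordOn⇒isReduced {w = w} ws-red , restrict-ws

theorem5p3 : (k n : ℕ) (p : Permutation′ k) (w : Permutation′ n) → Contains p w →
    (a b : ℕ) → CardR k p a → CardR n w b → a ≤ b
theorem5p3 k n p w p≺w a b (Lp , Lp-unique , Lp≡R[p] , refl) (Lw , _ , Lw≡R[w] , refl) = begin
  length Lp                ≤⟨ Unique-⊆⇒length-≤ Lp-unique Lp⊆restrict[Lw] ⟩
  length (map restrict Lw) ≡⟨ length-map restrict Lw ⟩
  length Lw ∎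
  where
  open Occurrence {p = p} {w} p≺w
  open ≤-Reasoning
  Lp⊆restrict[Lw] : ∀ {v} → v ∈ Lp → v ∈ map restrict Lw
  Lp⊆restrict[Lw] {v} v∈Lp with restrict-covers (proj₁ (Lp≡R[p] v) v∈Lp)
  ... | ws , ws-reduced , refl = ∈-map⁺ restrict (proj₂ (Lw≡R[w] ws) ws-reduced)
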